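{- Let $s,t,n\in\mathbb{N}$ with $s\geq t\geq 2$ and $n\geq 2s+t-1$, and let $\mathcal{F}\subseteq 2^{[n]}$ be the family described in the context. Let $F\in 2^{[n]}\setminus\mathcal{F}$ with $t\leq |F\cap[s+t-1]|< s+t-1$. Then $(\mathcal{F}\cup\{F\},\subseteq)$ contains an induced copy of $\mathcal{K}_{s,t}$.
   Context: The complete bipartite poset $\mathcal{K}_{s,t}$ consists of $s$ pairwise incomparable elements (upper layer) and $t$ pairwise incomparable elements (lower layer), every upper element larger than every lower element, and no other relations. A poset $\mathcal{Q}$ contains an induced copy of $\mathcal{P}$ if there is an injective $f:\mathcal{P}\to\mathcal{Q}$ with $f(x)\preceq f(y)$ iff $x\preceq y$. For integers $m\le k$, $[m,k]=\{m,\dots,k\}$ and $[k]=[1,k]$; complements are taken in $[n]$, so $A^c=[n]\setminus A$; $\binom{A}{k}$ is the family of $k$-element subsets of $A$. For $A\subseteq B\subseteq[n]$, a chain from $A$ to $B$ is a family of sets listable as $A=C_0\subsetneq C_1\subsetneq\dots\subsetneq C_r=B$; it is complete if it has exactly $|B\setminus A|+1$ members; two chains from $A$ to $B$ are internally disjoint if their intersection is $\{A,B\}$. If $\mathcal{L}$ is the union (as a family of sets) of $k$ pairwise internally disjoint complete chains from $A$ to $B$ with $|B\setminus A|\ge k$, let $X_1,\dots,X_k$ be its $k$ distinct members of size $|A|+1$ and $Y_1,\dots,Y_k$ its $k$ distinct members of size $|B|-1$; the first increment set of $\mathcal{L}$ is $\bigcup_{i=1}^k X_i\setminus A$ and the last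 increment set is $B\setminus\bigcap_{i=1}^k Y_i$. For $A\subseteq[s+t]$: an upper $s$-lantern $\mathcal{L}^s(A)$ is a union of $s-1$ pairwise internally disjoint complete chains from $A$ to $A\cup[s+t+1,n]$ whose last increment set is $[s+t+1,2s+t-1]$; a lower $t$-lantern $\mathcal{L}_t(A)$ is a union of $t-1$ pairwise internally disjoint complete chains from $A$ to $A\cup[s+t+1,n]$ whose first increment set is $[s+t+1,s+2t-1]$. For each relevant $A$ one such lantern is fixed. Define $\mathcal{F}_1=\{[n]\}\cup\{\{x\}^c: x\in[s+t-1]\}$; $\mathcal{F}_2=\bigcup_{A\in\binom{[s+t-1]}{t}}\mathcal{L}^s(A)$; $\mathcal{F}_3=\bigcup_{A\in\binom{[s+t-1]}{t-1}}\mathcal{L}_t(A\cup\{s+t\})$; $\mathcal{F}_4=\{\emptyset\}\cup\{\{x\}:x\in[s+t-1]\}$. Let $\mathcal{G}_1=\{A^c: A\subseteq[2s+t-1],\ 2\le|A|\le s\}$ and $\mathcal{G}_2=\{A\subseteq[s+2t-1]: 2\le |A|\le t\}$, and let $\mathcal{F}_5$ be a maximal subfamily of $\mathcal{G}_1\cup\mathcal{G}_2$ such that $\mathcal{F}_1\cup\dots\cup\mathcal{F}_5$ contains no induced copy of $\mathcal{K}_{s,t}$. Finally $\mathcal{F}=\mathcal{F}_1\cup\mathcal{F}_2\cup\mathcal{F}_3\cup\mathcal{F}_4\cup\mathcal{F}_5$. -}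

module Defs where

open import Data.Nat using (ℕ; zero; suc; _+_; _*_; _∸_; _≤_; _<_; _≤ᵇ_)
open import Data.Bool using (Bool; true; false; _∧_; T)
open import Data.Fin using (Fin; toℕ; fromℕ; inject₁)
open import Data.Fin.Subset using (Subset; _∈_; _∉_; _⊆_; _⊂_; _∪_; _∩_; _─_; ∁; ∣_∣; ⁅_⁆; ⊤; ⊥)
open import Data.Vec using (tabulate)
open import Data.Sum using (_⊎_; inj₁; inj₂)
open import Data.Product using (_×_; ∃-syntax; Σ-syntax)
open import Relation.Nullary using (¬_)
open import Relation.Binary.PropositionalEquality using (_≡_; _≢_)
open import Function.Definitions using (Injective)

-- Ground set [n] = {1,…,n} is represented by Fin n: the index i : Fin n
-- stands for the element  elem i = toℕ i + 1.  A subset of [n] is a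
-- Subset n (= Vec Bool n).

elem : {n : ℕ} → Fin n → ℕ
elem i = suc (toℕ i)

Family : ℕ → Set₁
Family n = Subset n → Set

interval : {n : ℕ} → ℕ → ℕ → Subset n
interval a b = tabulate (λ i → (a ≤ᵇ elem i) ∧ (elem i ≤ᵇ b))

-- Induced copies of the complete bipartite poset K_{s,t}.
-- Elements: inj₁ i (upper layer, i : Fin s), inj₂ j (lower layer, j : Fin t).

data _≼K_ {s t : ℕ} : Fin s ⊎ Fin t → Fin s ⊎ Fin t → Set where
  K-refl   : ∀ {x} → x ≼K x
  K-lowup  : ∀ (i : Fin s) (j : Fin t) → inj₂ j ≼K inj₁ i

InducedK : {n : ℕ} (s t : ℕ) → Family n → Set
InducedK {n} s t 𝒬 =
  Σ[ f ∈ (Fin s ⊎ Fin t → Subset n) ]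
    ( (∀ x → 𝒬 (f x))
    × Injective _≡_ _≡_ f
    × (∀ x y → (f x ⊆ f y → x ≼K y) × (x ≼K y → f x ⊆ f y)) )

Chain : ℕ → ℕ → Set
Chain n r = Fin (suc r) → Subset n

IsCompleteChain : {n r : ℕ} → Subset n → Subset n → Chain n r → Set
IsCompleteChain {n} {r} A B c =
  (c Data.Fin.zero ≡ A) × (c (fromℕ r) ≡ B)
  × (∀ (i : Fin r) → c (inject₁ i) ⊂ c (Data.Fin.suc i))
  × (r ≡ ∣ B ─ A ∣)

_∈Ch_ : {n r : ℕ} → Subset n → Chain n r → Set
X ∈Ch c = ∃[ j ] (c j ≡ X)

-- k listed chains (the lantern is the union of their members)
Lantern : ℕ → ℕ → ℕ → Set
Lantern n k r = Fin k → Chain n r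

_∈L_ : {n k r : ℕ} → Subset n → Lantern n k r → Set
X ∈L L = ∃[ i ] (X ∈Ch L i)

IsLantern : {n k r : ℕ} → Subset n → Subset n → Lantern n k r → Set
IsLantern {n} {k} A B L =
  (∀ i → IsCompleteChain A B (L i))
  × (∀ i i' → i ≢ i' → ∀ X → X ∈Ch L i → X ∈Ch L i' → (X ≡ A) ⊎ (X ≡ B))

-- first increment set: (⋃ of members of size |A|+1) ∖ A
FirstInc : {n k r : ℕ} → Subset n → Lantern n k r → Fin n → Set
FirstInc A L x = x ∉ A × ∃[ X ] (X ∈L L × ∣ X ∣ ≡ suc ∣ A ∣ × x ∈ X)

-- last increment set: B ∖ (⋂ of members of size |B|-1)
LastInc : {n k r : ℕ} → Subset n → Lantern n k r → Fin n → Set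
LastInc B L x = x ∈ B × ¬ (∀ Y → Y ∈L L → suc ∣ Y ∣ ≡ ∣ B ∣ → x ∈ Y)

_≐_ : {n : ℕ} → (Fin n → Set) → Subset n → Set
P ≐ S = ∀ x → (P x → x ∈ S) × (x ∈ S → P x)

Top : {n : ℕ} (s t : ℕ) → Subset n → Subset n
Top {n} s t A = A ∪ interval (suc (s + t)) n

-- the chains all have length r = n - s - t (= |B ∖ A| whenever A ⊆ [s+t];
-- this is also enforced by IsCompleteChain)
UpperLanternData : (s t n : ℕ) → Set
UpperLanternData s t n = Lantern n (s ∸ 1) (n ∸ (s + t))

LowerLanternData : (s t n : ℕ) → Set
LowerLanternData s t n = Lantern n (t ∸ 1) (n ∸ (s + t))

IsUpperLantern : {n : ℕ} (s t : ℕ) → Subset n → UpperLanternData s t n → Set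
IsUpperLantern s t A L =
  IsLantern A (Top s t A) L
  × (LastInc (Top s t A) L ≐ interval (suc (s + t)) (2 * s + t ∸ 1))

IsLowerLantern : {n : ℕ} (s t : ℕ) → Subset n → LowerLanternData s t n → Set
IsLowerLantern s t A L =
  IsLantern A (Top s t A) L
  × (FirstInc A L ≐ interval (suc (s + t)) (s + 2 * t ∸ 1))

Low : {n : ℕ} (s t : ℕ) → Subset n
Low s t = interval 1 (s + t ∸ 1)

Pt : {n : ℕ} (s t : ℕ) → Subset n
Pt s t = interval (s + t) (s + t)

𝓕₁ : {n : ℕ} (s t : ℕ) → Family n
𝓕₁ s t X = (X ≡ ⊤) ⊎ ∃[ x ] (elem x ≤ s + t ∸ 1 × X ≡ ∁ ⁅ x ⁆)

𝓕₄ : {n : ℕ} (s t : ℕ) → Family n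
𝓕₄ s t X = (X ≡ ⊥) ⊎ ∃[ x ] (elem x ≤ s + t ∸ 1 × X ≡ ⁅ x ⁆)

-- the fixed lanterns: data for every A, properties for the relevant A
𝓕₂ : {n : ℕ} (s t : ℕ) → (Subset n → UpperLanternData s t n) → Family n
𝓕₂ s t up X = ∃[ A ] (A ⊆ Low s t × ∣ A ∣ ≡ t × X ∈L up A)

𝓕₃ : {n : ℕ} (s t : ℕ) → (Subset n → LowerLanternData s t n) → Family n
𝓕₃ s t low X = ∃[ A ] (A ⊆ Low s t × ∣ A ∣ ≡ t ∸ 1 × X ∈L low A)

𝓖₁ : {n : ℕ} (s t : ℕ) → Family n
𝓖₁ s t X = ∃[ A ] (A ⊆ interval 1 (2 * s + t ∸ 1) × 2 ≤ ∣ A ∣ × ∣ A ∣ ≤ s × X ≡ ∁ A)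

𝓖₂ : {n : ℕ} (s t : ℕ) → Family n
𝓖₂ s t X = X ⊆ interval 1 (s + 2 * t ∸ 1) × 2 ≤ ∣ X ∣ × ∣ X ∣ ≤ t

Base+ : {n : ℕ} (s t : ℕ) → (Subset n → UpperLanternData s t n)
      → (Subset n → LowerLanternData s t n) → (Subset n → Bool) → Family n
Base+ s t up low H X =
  𝓕₁ s t X ⊎ 𝓕₂ s t up X ⊎ 𝓕₃ s t low X ⊎ 𝓕₄ s t X ⊎ T (H X)

record Construction (s t n : ℕ) : Set where
  field
    up     : Subset n → UpperLanternData s t n
    up-ok  : ∀ A → A ⊆ Low s t → ∣ A ∣ ≡ t → IsUpperLantern s t A (up A)
    low    : Subset n → LowerLanternData s t n
    low-ok : ∀ A → A ⊆ Low s t → ∣ A ∣ ≡ t ∸ 1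
             → IsLowerLantern s t (A ∪ Pt s t) (low A)
    F₅     : Subset n → Bool
    F₅⊆𝓖   : ∀ X → T (F₅ X) → 𝓖₁ s t X ⊎ 𝓖₂ s t X
    F₅-free : ¬ InducedK s t (Base+ s t up low F₅)
    F₅-max : ∀ (H : Subset n → Bool)
             → (∀ X → T (F₅ X) → T (H X))
             → (∀ X → T (H X) → 𝓖₁ s t X ⊎ 𝓖₂ s t X)
             → ¬ InducedK s t (Base+ s t up low H)
             → ∀ X → T (H X) → T (F₅ X)

𝓕 : {s t n : ℕ} → Construction s t n → Family n
𝓕 {s} {t} C = Base+ s t (Construction.up C) (Construction.low C) (Construction.F₅ C)

-- Pick a t-subset A of F ∩ [s+t-1]. Every member of the upper lantern L^s(A) contains A, so if some
-- level of its s-1 chains consists of sets incomparable to F, then F and that level form the upper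
-- layer, and the singletons of A (in 𝓕₄) the lower layer, of a copy of K_{s,t}. If F is smaller than
-- the top A ∪ [s+t+1,n] of the lantern, the level of size ∣F∣ works since F ∉ 𝓕. If F is at least
-- that large but misses a point z > 2s+t-1, the level just below the top works: z is not in the last
-- increment set, so it lies in all of that level. Otherwise ∁F ⊆ [2s+t-1] has between 2 and s
-- elements, i.e. F ∈ 𝓖₁, and the maximality of 𝓕₅ provides the copy.
module Submission where

open import Defs
open import Data.Nat using (ℕ; zero; suc; _+_; _*_; _∸_; _≤_; _<_; z≤n; s≤s; s≤s⁻¹)
open import Data.Nat.Properties
open import Data.Nat.Tactic.RingSolver using (solve-∀)
open import Data.Bool using (Bool; true; false; T; _∨_)
open import Data.Bool.Properties using (T-≡; T-∧; T-∨; not-involutive)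
import Data.Bool as Bool
open import Data.Vec using (_∷_; []; tabulate; here; there)
open import Data.Vec.Properties using (≡-dec; lookup∘tabulate; []=⇒lookup; lookup⇒[]=)
import Data.Vec.Functional as Vector
open import Data.Fin using (Fin; zero; suc; toℕ; fromℕ; fromℕ<; inject₁)
open import Data.Fin.Properties using (any?; all?; toℕ<n; toℕ≤pred[n]; toℕ-fromℕ<)
  renaming (_≟_ to _≟ᶠ_; suc-injective to fsuc-injective)
open import Data.Fin.Subset
  using (Subset; _∈_; _∉_; _⊆_; _⊂_; _∩_; _─_; ∁; ∣_∣; ⁅_⁆; ⊤; ⊥)
open import Data.Fin.Subset.Properties
open import Data.Sum using (_⊎_; inj₁; inj₂; [_,_]; [_,_]′)
open import Data.Product using (_×_; _,_; proj₁; proj₂; ∃)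
open import Data.Empty using (⊥-elim)
open import Function using (_∘_; _⇔_; mk⇔; Equivalence)
open import Function.Definitions using (Injective)
open import Relation.Nullary using (¬_; Dec; yes; no)
open import Relation.Nullary.Decidable using (map′; _×-dec_; _⊎-dec_; _→-dec_; ¬?; isYes; toWitness; fromWitness)
open import Relation.Unary using (Decidable)
open import Relation.Binary.PropositionalEquality
  using (_≡_; _≢_; refl; sym; trans; cong; cong₂; subst; subst₂; _≗_; module ≡-Reasoning)

private
  variable
    n : ℕ

_≟ₛ_ : (p q : Subset n) → Dec (p ≡ q)
_≟ₛ_ = ≡-dec Bool._≟_

∈-tabulate : (f : Fin n → Bool) {x : Fin n} → x ∈ tabulate f ⇔ T (f x)
∈-tabulate f {x} = mk⇔
  (λ x∈ → Equivalence.from T-≡ (trans (sym (lookup∘tabulate f x)) ([]=⇒lookup x∈)))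
  (λ fx → lookup⇒[]= x _ (trans (lookup∘tabulate f x) (Equivalence.to T-≡ fx)))

∈-interval⁻ : ∀ {a b} {x : Fin n} → x ∈ interval a b → a ≤ elem x × elem x ≤ b
∈-interval⁻ {a = a} {b} x∈ with Equivalence.to T-∧ (Equivalence.to (∈-tabulate _) x∈)
... | a≤x , x≤b = ≤ᵇ⇒≤ a _ a≤x , ≤ᵇ⇒≤ _ b x≤b

∈-interval⁺ : ∀ {a b} {x : Fin n} → a ≤ elem x → elem x ≤ b → x ∈ interval a b
∈-interval⁺ a≤x x≤b = Equivalence.from (∈-tabulate _) (Equivalence.from T-∧ (≤⇒≤ᵇ a≤x , ≤⇒≤ᵇ x≤b))

∣[1,m]∣≡m : ∀ n m → m ≤ n → ∣ interval {n} 1 m ∣ ≡ m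
∣[1,m]∣≡m zero    zero    _         = refl
∣[1,m]∣≡m (suc n) zero    _         = ∣[1,m]∣≡m n zero z≤n
∣[1,m]∣≡m (suc n) (suc m) (s≤s m≤n) = cong suc (∣[1,m]∣≡m n m m≤n)

∁-involutive : (p : Subset n) → ∁ (∁ p) ≡ p
∁-involutive []      = refl
∁-involutive (b ∷ p) = cong₂ _∷_ (not-involutive b) (∁-involutive p)

p⊆q∧∣p∣≡∣q∣⇒p≡q : {p q : Subset n} → p ⊆ q → ∣ p ∣ ≡ ∣ q ∣ → p ≡ q
p⊆q∧∣p∣≡∣q∣⇒p≡q {p = []}        {[]}        _   _ = refl
p⊆q∧∣p∣≡∣q∣⇒p≡q {p = true ∷ p}  {true ∷ q}  p⊆q e =
  cong (true ∷_) (p⊆q∧∣p∣≡∣q∣⇒p≡q (drop-∷-⊆ p⊆q) (suc-injective e))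
p⊆q∧∣p∣≡∣q∣⇒p≡q {p = false ∷ p} {false ∷ q} p⊆q e =
  cong (false ∷_) (p⊆q∧∣p∣≡∣q∣⇒p≡q (drop-∷-⊆ p⊆q) e)
p⊆q∧∣p∣≡∣q∣⇒p≡q {p = false ∷ p} {true ∷ q}  p⊆q e =
  ⊥-elim (<-irrefl refl (subst (_≤ ∣ q ∣) e (p⊆q⇒∣p∣≤∣q∣ (drop-∷-⊆ p⊆q))))
p⊆q∧∣p∣≡∣q∣⇒p≡q {p = true ∷ p}  {false ∷ q} p⊆q e with p⊆q here
... | ()

p⊆q⇒∣q∣≡∣p∣+∣q─p∣ : {p q : Subset n} → p ⊆ q → ∣ q ∣ ≡ ∣ p ∣ + ∣ q ─ p ∣
p⊆q⇒∣q∣≡∣p∣+∣q─p∣ {p = []}        {[]}        _   = refl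
p⊆q⇒∣q∣≡∣p∣+∣q─p∣ {p = true ∷ p}  {true ∷ q}  p⊆q = cong suc (p⊆q⇒∣q∣≡∣p∣+∣q─p∣ (drop-∷-⊆ p⊆q))
p⊆q⇒∣q∣≡∣p∣+∣q─p∣ {p = false ∷ p} {false ∷ q} p⊆q = p⊆q⇒∣q∣≡∣p∣+∣q─p∣ (drop-∷-⊆ p⊆q)
p⊆q⇒∣q∣≡∣p∣+∣q─p∣ {p = false ∷ p} {true ∷ q}  p⊆q =
  trans (cong suc (p⊆q⇒∣q∣≡∣p∣+∣q─p∣ (drop-∷-⊆ p⊆q))) (sym (+-suc ∣ p ∣ _))
p⊆q⇒∣q∣≡∣p∣+∣q─p∣ {p = true ∷ p}  {false ∷ q} p⊆q with p⊆q here
... | ()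

∃-subset-of-size : ∀ {t} (p : Subset n) → t ≤ ∣ p ∣ → ∃ λ q → q ⊆ p × ∣ q ∣ ≡ t
∃-subset-of-size {n} {zero} p _ = ⊥ , (λ x∈⊥ → ⊥-elim (∉⊥ x∈⊥)) , ∣⊥∣≡0 n
∃-subset-of-size {t = suc t} (true ∷ p) (s≤s t≤∣p∣) with ∃-subset-of-size p t≤∣p∣
... | q , q⊆p , ∣q∣≡t = true ∷ q , (λ { here → here ; (there x∈q) → there (q⊆p x∈q) }) , cong suc ∣q∣≡t
∃-subset-of-size {t = suc t} (false ∷ p) t≤∣p∣ with ∃-subset-of-size p t≤∣p∣
... | q , q⊆p , ∣q∣≡t = false ∷ q , (λ { (there x∈q) → there (q⊆p x∈q) }) , ∣q∣≡t

∣p∩q∣<∣q∣⇒∃∉ : (p q : Subset n) → ∣ p ∩ q ∣ < ∣ q ∣ → ∃ λ x → x ∈ q × x ∉ p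
∣p∩q∣<∣q∣⇒∃∉ p q ∣p∩q∣<∣q∣ with any? (λ x → x ∈? q ×-dec ¬? (x ∈? p))
... | yes witness = witness
... | no  none    = ⊥-elim (<⇒≱ ∣p∩q∣<∣q∣ (p⊆q⇒∣p∣≤∣q∣ q⊆p∩q))
  where
  q⊆p∩q : q ⊆ p ∩ q
  q⊆p∩q {x} x∈q with x ∈? p
  ... | yes x∈p = x∈p∩q⁺ (x∈p , x∈q)
  ... | no  x∉p = ⊥-elim (none (x , x∈q , x∉p))

enumerate : (p : Subset n) → ∃ λ (e : Fin ∣ p ∣ → Fin n) → Injective _≡_ _≡_ e × (∀ k → e k ∈ p)
enumerate []          = (λ ()) , (λ { {()} }) , λ ()
enumerate (false ∷ p) with enumerate p
... | e , e-inj , e∈p = suc ∘ e , e-inj ∘ fsuc-injective , there ∘ e∈p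
enumerate (true ∷ p)  with enumerate p
... | e , e-inj , e∈p = zero Vector.∷ (suc ∘ e) , inj , λ { zero → here ; (suc k) → there (e∈p k) }
  where
  inj : Injective _≡_ _≡_ (zero Vector.∷ (suc ∘ e))
  inj {zero}  {zero}  _ = refl
  inj {suc k} {suc l} e = cong suc (e-inj (fsuc-injective e))

enumerate-sized : ∀ {k} (p : Subset n) → ∣ p ∣ ≡ k → ∃ λ (e : Fin k → Fin n) → Injective _≡_ _≡_ e × (∀ i → e i ∈ p)
enumerate-sized p refl = enumerate p

StrictlyIncreasing : ∀ {r} → Chain n r → Set
StrictlyIncreasing {r = r} c = ∀ (k : Fin r) → c (inject₁ k) ⊂ c (suc k)

chain-grows-from-bottom : ∀ r (c : Chain n r) → StrictlyIncreasing c
                        → ∀ k → c zero ⊆ c k × ∣ c zero ∣ + toℕ k ≤ ∣ c k ∣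
chain-grows-from-bottom r       c inc zero    = ⊆-refl , ≤-reflexive (+-identityʳ _)
chain-grows-from-bottom (suc r) c inc (suc k) with chain-grows-from-bottom r (c ∘ suc) (inc ∘ suc) k
... | c₁⊆cₖ , ∣c₁∣+k≤∣cₖ∣ =
  ⊆-trans (p⊂q⇒p⊆q (inc zero)) c₁⊆cₖ ,
  ≤-trans (≤-reflexive (+-suc _ (toℕ k))) (≤-trans (+-monoˡ-≤ (toℕ k) (p⊂q⇒∣p∣<∣q∣ (inc zero))) ∣c₁∣+k≤∣cₖ∣)

chain-grows-to-top : ∀ r (c : Chain n r) → StrictlyIncreasing c
                   → ∀ k → ∣ c k ∣ + (r ∸ toℕ k) ≤ ∣ c (fromℕ r) ∣
chain-grows-to-top zero    c inc zero    = ≤-reflexive (+-identityʳ _)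
chain-grows-to-top (suc r) c inc zero    =
  ≤-trans (≤-reflexive (+-suc _ r))
          (≤-trans (+-monoˡ-≤ r (p⊂q⇒∣p∣<∣q∣ (inc zero))) (chain-grows-to-top r (c ∘ suc) (inc ∘ suc) zero))
chain-grows-to-top (suc r) c inc (suc k) = chain-grows-to-top r (c ∘ suc) (inc ∘ suc) k

complete-chain-sizes : ∀ {r} {A B : Subset n} (c : Chain n r) → IsCompleteChain A B c
                     → ∣ B ∣ ≡ ∣ A ∣ + r × (∀ k → A ⊆ c k × ∣ c k ∣ ≡ ∣ A ∣ + toℕ k)
complete-chain-sizes {r = r} c (refl , refl , inc , r≡∣B─A∣) = ∣B∣≡∣A∣+r , level
  where
  ∣B∣≡∣A∣+r : ∣ c (fromℕ r) ∣ ≡ ∣ c zero ∣ + r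
  ∣B∣≡∣A∣+r = trans (p⊆q⇒∣q∣≡∣p∣+∣q─p∣ (proj₁ (chain-grows-from-bottom r c inc (fromℕ r))))
                    (cong (∣ c zero ∣ +_) (sym r≡∣B─A∣))
  level : ∀ k → c zero ⊆ c k × ∣ c k ∣ ≡ ∣ c zero ∣ + toℕ k
  level k = proj₁ (chain-grows-from-bottom r c inc k) , ≤-antisym ∣cₖ∣≤ (proj₂ (chain-grows-from-bottom r c inc k))
    where
    ∣cₖ∣≤ : ∣ c k ∣ ≤ ∣ c zero ∣ + toℕ k
    ∣cₖ∣≤ = +-cancelʳ-≤ (r ∸ toℕ k) _ _ (≤-trans (chain-grows-to-top r c inc k) (≤-reflexive (begin
      ∣ c (fromℕ r) ∣                     ≡⟨ ∣B∣≡∣A∣+r ⟩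
      ∣ c zero ∣ + r                      ≡⟨ cong (∣ c zero ∣ +_) (sym (m+[n∸m]≡n (toℕ≤pred[n] k))) ⟩
      ∣ c zero ∣ + (toℕ k + (r ∸ toℕ k))  ≡⟨ sym (+-assoc ∣ c zero ∣ (toℕ k) _) ⟩
      ∣ c zero ∣ + toℕ k + (r ∸ toℕ k)    ∎)))
      where open ≡-Reasoning

lantern-level-injective : ∀ {k r} {A B : Subset n} {L : Lantern n k r} → IsLantern A B L
                        → (j : Fin (suc r)) → 1 ≤ toℕ j → toℕ j < r → Injective _≡_ _≡_ (λ i → L i j)
lantern-level-injective {A = A} {L = L} (complete , disjoint) j 0<j j<r {i} {i′} Lij≡Li′j with i ≟ᶠ i′
... | yes i≡i′ = i≡i′
... | no  i≢i′ = ⊥-elim ([ (λ Lij≡A → <-irrefl (sym (offset 0 (trans (cong ∣_∣ Lij≡A) (sym (+-identityʳ ∣ A ∣))))) 0<j)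
                         , (λ Lij≡B → <-irrefl (offset _ (trans (cong ∣_∣ Lij≡B) (proj₁ (complete-chain-sizes (L i) (complete i))))) j<r)
                         ]′ (disjoint i i′ i≢i′ (L i j) (j , refl) (j , sym Lij≡Li′j)))
  where
  offset : ∀ m → ∣ L i j ∣ ≡ ∣ A ∣ + m → toℕ j ≡ m
  offset m ∣Lij∣≡∣A∣+m = +-cancelˡ-≡ ∣ A ∣ (toℕ j) m (trans (sym (proj₂ (proj₂ (complete-chain-sizes (L i) (complete i)) j))) ∣Lij∣≡∣A∣+m)

Incomparable : Subset n → Subset n → Set
Incomparable X Y = ¬ X ⊆ Y × ¬ Y ⊆ X

Antichain : ∀ {m} → (Fin m → Subset n) → Set
Antichain U = ∀ i j → U i ⊆ U j → i ≡ j

≢∧equal-size⇒incomparable : {X Y : Subset n} → X ≢ Y → ∣ X ∣ ≡ ∣ Y ∣ → Incomparable X Y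
≢∧equal-size⇒incomparable X≢Y ∣X∣≡∣Y∣ =
  (λ X⊆Y → X≢Y (p⊆q∧∣p∣≡∣q∣⇒p≡q X⊆Y ∣X∣≡∣Y∣)) , (λ Y⊆X → X≢Y (sym (p⊆q∧∣p∣≡∣q∣⇒p≡q Y⊆X (sym ∣X∣≡∣Y∣))))

injective∧equal-size⇒antichain : ∀ {m k} {U : Fin m → Subset n}
                               → Injective _≡_ _≡_ U → (∀ i → ∣ U i ∣ ≡ k) → Antichain U
injective∧equal-size⇒antichain U-inj ∣U∣≡k i j Ui⊆Uj =
  U-inj (p⊆q∧∣p∣≡∣q∣⇒p≡q Ui⊆Uj (trans (∣U∣≡k i) (sym (∣U∣≡k j))))

antichain-∷ : ∀ {m} {X : Subset n} {U : Fin m → Subset n}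
            → (∀ i → Incomparable X (U i)) → Antichain U → Antichain (X Vector.∷ U)
antichain-∷ X∥U U-anti zero    zero    _     = refl
antichain-∷ X∥U U-anti zero    (suc j) X⊆Uj  = ⊥-elim (proj₁ (X∥U j) X⊆Uj)
antichain-∷ X∥U U-anti (suc i) zero    Ui⊆X  = ⊥-elim (proj₂ (X∥U i) Ui⊆X)
antichain-∷ X∥U U-anti (suc i) (suc j) Ui⊆Uj = cong suc (U-anti i j Ui⊆Uj)

module _ {s t : ℕ} where

  ≡⇒≼K : {x y : Fin s ⊎ Fin t} → x ≡ y → x ≼K y
  ≡⇒≼K refl = K-refl

  ≼K-antisym : {x y : Fin s ⊎ Fin t} → x ≼K y → y ≼K x → x ≡ y
  ≼K-antisym K-refl _ = refl

  _≼K?_ : (x y : Fin s ⊎ Fin t) → Dec (x ≼K y)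
  inj₁ i ≼K? inj₁ i′ = map′ (≡⇒≼K ∘ cong inj₁) (λ { K-refl → refl }) (i ≟ᶠ i′)
  inj₁ i ≼K? inj₂ k  = no λ ()
  inj₂ k ≼K? inj₁ i  = yes (K-lowup i k)
  inj₂ k ≼K? inj₂ k′ = map′ (≡⇒≼K ∘ cong inj₂) (λ { K-refl → refl }) (k ≟ᶠ k′)

  IsKEmbedding : (Fin s ⊎ Fin t → Subset n) → Set
  IsKEmbedding f = ∀ x y → (f x ⊆ f y → x ≼K y) × (x ≼K y → f x ⊆ f y)

  IsKEmbedding⇒injective : {f : Fin s ⊎ Fin t → Subset n} → IsKEmbedding f → Injective _≡_ _≡_ f
  IsKEmbedding⇒injective f-emb {x} {y} fx≡fy =
    ≼K-antisym (proj₁ (f-emb x y) (⊆-reflexive fx≡fy)) (proj₁ (f-emb y x) (⊆-reflexive (sym fx≡fy)))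

  inducedK : {Q : Family n} (f : Fin s ⊎ Fin t → Subset n)
           → (∀ x → Q (f x)) → IsKEmbedding f → InducedK s t Q
  inducedK f f∈Q f-emb = f , f∈Q , IsKEmbedding⇒injective f-emb , f-emb

  inducedK-mono : {Q Q′ : Family n} → (∀ X → Q X → Q′ X) → InducedK s t Q → InducedK s t Q′
  inducedK-mono Q⊆Q′ (f , f∈Q , f-inj , f-emb) = f , (λ x → Q⊆Q′ (f x) (f∈Q x)) , f-inj , f-emb

antichain-over-points⇒IsKEmbedding :
  ∀ {s t} (U : Fin s → Subset n) (e : Fin (2 + t) → Fin n) → Injective _≡_ _≡_ e
  → (∀ i k → e k ∈ U i) → Antichain U → IsKEmbedding [ U , ⁅_⁆ ∘ e ]′
antichain-over-points⇒IsKEmbedding U e e-inj e∈U U-anti x y = reflects x y , preserves x y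
  where
  reflects : ∀ x y → [ U , ⁅_⁆ ∘ e ]′ x ⊆ [ U , ⁅_⁆ ∘ e ]′ y → x ≼K y
  reflects (inj₁ i) (inj₁ i′) Ui⊆Ui′ = ≡⇒≼K (cong inj₁ (U-anti i i′ Ui⊆Ui′))
  reflects (inj₁ i) (inj₂ k)  Ui⊆ek  with e-inj {zero} {suc zero}
    (trans (x∈⁅y⁆⇒x≡y (e k) (Ui⊆ek (e∈U i zero))) (sym (x∈⁅y⁆⇒x≡y (e k) (Ui⊆ek (e∈U i (suc zero))))))
  ... | ()
  reflects (inj₂ k) (inj₁ i)  _      = K-lowup i k
  reflects (inj₂ k) (inj₂ k′) ek⊆ek′ = ≡⇒≼K (cong inj₂ (e-inj (x∈⁅y⁆⇒x≡y (e k′) (ek⊆ek′ (x∈⁅x⁆ (e k))))))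
  preserves : ∀ x y → x ≼K y → [ U , ⁅_⁆ ∘ e ]′ x ⊆ [ U , ⁅_⁆ ∘ e ]′ y
  preserves x .x K-refl = ⊆-refl
  preserves .(inj₂ k) .(inj₁ i) (K-lowup i k) x∈ek = subst (_∈ U i) (sym (x∈⁅y⁆⇒x≡y (e k) x∈ek)) (e∈U i k)

Searchable : Set → Set₁
Searchable A = ∀ {P : A → Set} → Decidable P → Dec (∃ P)

RespectsPointwise : ∀ {I A : Set} → ((I → A) → Set) → Set
RespectsPointwise P = ∀ {f g} → f ≗ g → P f → P g

module _ {A : Set} (search : Searchable A) where

  search-Fin→ : ∀ m {P : (Fin m → A) → Set} → RespectsPointwise P → Decidable P → Dec (∃ P)
  search-Fin→ zero {P} resp P? = map′ ((λ ()) ,_) from-any (P? (λ ()))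
    where
    from-any : ∃ P → P (λ ())
    from-any (f , p) = resp (λ ()) p
  search-Fin→ (suc m) {P} resp P? =
    map′ (λ (a , f , p) → a Vector.∷ f , p) (λ (f , p) → f zero , f ∘ suc , resp head∷tail p)
         (search λ a → search-Fin→ m (λ f≗g → resp (λ { zero → refl ; (suc k) → f≗g k })) (P? ∘ (a Vector.∷_)))
    where
    head∷tail : ∀ {f : Fin (suc m) → A} → f ≗ f zero Vector.∷ f ∘ suc
    head∷tail zero    = refl
    head∷tail (suc k) = refl

  search-⊎→ : ∀ s t {P : (Fin s ⊎ Fin t → A) → Set} → RespectsPointwise P → Decidable P → Dec (∃ P)
  search-⊎→ s t {P} resp P? =
    map′ (λ (g , h , p) → [ g , h ]′ , p) (λ (f , p) → f ∘ inj₁ , f ∘ inj₂ , resp split p)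
         (search-Fin→ s respˡ λ g → search-Fin→ t (λ h≗h′ → resp [ (λ _ → refl) , h≗h′ ]) (P? ∘ [ g ,_]′))
    where
    split : ∀ {f : Fin s ⊎ Fin t → A} → f ≗ [ f ∘ inj₁ , f ∘ inj₂ ]′
    split (inj₁ _) = refl
    split (inj₂ _) = refl
    respˡ : RespectsPointwise (λ g → ∃ λ h → P [ g , h ]′)
    respˡ g≗g′ (h , p) = h , resp [ g≗g′ , (λ _ → refl) ] p

module _ {s t : ℕ} where

  all⊎? : {P : Fin s ⊎ Fin t → Set} → Decidable P → Dec (∀ x → P x)
  all⊎? P? = map′ (λ (p , q) → [ p , q ]) (λ p → p ∘ inj₁ , p ∘ inj₂) (all? (P? ∘ inj₁) ×-dec all? (P? ∘ inj₂))

  IsKEmbedding? : (f : Fin s ⊎ Fin t → Subset n) → Dec (IsKEmbedding f)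
  IsKEmbedding? f = all⊎? λ x → all⊎? λ y → ((f x ⊆? f y) →-dec (x ≼K? y)) ×-dec ((x ≼K? y) →-dec (f x ⊆? f y))

  InducedK? : {Q : Family n} → Decidable Q → Dec (InducedK s t Q)
  InducedK? {Q = Q} Q? =
    map′ (λ (f , f∈Q , f-emb) → inducedK {Q = Q} f f∈Q f-emb) (λ (f , f∈Q , _ , f-emb) → f , f∈Q , f-emb)
         (search-⊎→ anySubset? s t resp (λ f → all⊎? (Q? ∘ f) ×-dec IsKEmbedding? f))
    where
    resp : RespectsPointwise (λ f → (∀ x → Q (f x)) × IsKEmbedding f)
    resp f≗g (f∈Q , f-emb) =
      (λ x → subst Q (f≗g x) (f∈Q x)) ,
      λ x y → (λ gx⊆gy → proj₁ (f-emb x y) (subst₂ _⊆_ (sym (f≗g x)) (sym (f≗g y)) gx⊆gy)) ,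
              (λ x≼y → subst₂ _⊆_ (f≗g x) (f≗g y) (proj₂ (f-emb x y) x≼y))

_∈L?_ : ∀ {k r} (X : Subset n) (L : Lantern n k r) → Dec (X ∈L L)
X ∈L? L = any? λ i → any? λ j → L i j ≟ₛ X

Base+? : ∀ {s t} (up : Subset n → UpperLanternData s t n) (low : Subset n → LowerLanternData s t n)
         (H : Subset n → Bool) → Decidable (Base+ s t up low H)
Base+? {s = s} {t} up low H X =
  ((X ≟ₛ ⊤) ⊎-dec any? (λ x → (elem x ≤? s + t ∸ 1) ×-dec (X ≟ₛ ∁ ⁅ x ⁆)))
  ⊎-dec anySubset? (λ A → (A ⊆? Low s t) ×-dec (∣ A ∣ ≟ t) ×-dec (X ∈L? up A))
  ⊎-dec anySubset? (λ A → (A ⊆? Low s t) ×-dec (∣ A ∣ ≟ t ∸ 1) ×-dec (X ∈L? low A))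
  ⊎-dec ((X ≟ₛ ⊥) ⊎-dec any? (λ x → (elem x ≤? s + t ∸ 1) ×-dec (X ≟ₛ ⁅ x ⁆)))
  ⊎-dec Bool.T? (H X)

module _ {s t : ℕ} (C : Construction s t n) {F : Subset n} where
  open Construction C

  private
    F₅+F : Subset n → Bool
    F₅+F X = F₅ X ∨ isYes (X ≟ₛ F)

    Base+F⇒𝓕+F : ∀ X → Base+ s t up low F₅+F X → 𝓕 C X ⊎ X ≡ F
    Base+F⇒𝓕+F X (inj₂ (inj₂ (inj₂ (inj₂ X∈F₅+F)))) with Equivalence.to T-∨ X∈F₅+F
    ... | inj₁ X∈F₅ = inj₁ (inj₂ (inj₂ (inj₂ (inj₂ X∈F₅))))
    ... | inj₂ X≟F  = inj₂ (toWitness X≟F)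
    Base+F⇒𝓕+F X (inj₁ X∈𝓕₁)                      = inj₁ (inj₁ X∈𝓕₁)
    Base+F⇒𝓕+F X (inj₂ (inj₁ X∈𝓕₂))               = inj₁ (inj₂ (inj₁ X∈𝓕₂))
    Base+F⇒𝓕+F X (inj₂ (inj₂ (inj₁ X∈𝓕₃)))        = inj₁ (inj₂ (inj₂ (inj₁ X∈𝓕₃)))
    Base+F⇒𝓕+F X (inj₂ (inj₂ (inj₂ (inj₁ X∈𝓕₄)))) = inj₁ (inj₂ (inj₂ (inj₂ (inj₁ X∈𝓕₄))))

    F₅+F⊆𝓖 : 𝓖₁ s t F ⊎ 𝓖₂ s t F → ∀ X → T (F₅+F X) → 𝓖₁ s t X ⊎ 𝓖₂ s t X
    F₅+F⊆𝓖 F∈𝓖 X X∈F₅+F = [ F₅⊆𝓖 X , (λ X≟F → subst (λ Y → 𝓖₁ s t Y ⊎ 𝓖₂ s t Y) (sym (toWitness X≟F)) F∈𝓖) ]′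
                              (Equivalence.to T-∨ X∈F₅+F)

  -- By maximality of F₅, adding F to it creates a copy of K_{s,t}; that copy can be exhibited
  -- because having one is decidable.
  𝓖-member⇒inducedK : ¬ 𝓕 C F → 𝓖₁ s t F ⊎ 𝓖₂ s t F → InducedK s t (λ X → 𝓕 C X ⊎ X ≡ F)
  𝓖-member⇒inducedK F∉𝓕 F∈𝓖 with InducedK? {s = s} {t} (Base+? {s = s} {t} up low F₅+F)
  ... | yes K = inducedK-mono Base+F⇒𝓕+F K
  ... | no ¬K = ⊥-elim (F∉𝓕 (inj₂ (inj₂ (inj₂ (inj₂ F∈F₅)))))
    where
    F∈F₅ : T (F₅ F)
    F∈F₅ = F₅-max F₅+F (λ X X∈F₅ → Equivalence.from T-∨ (inj₁ X∈F₅)) (F₅+F⊆𝓖 F∈𝓖) ¬K F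
             (Equivalence.from (T-∨ {F₅ F}) (inj₂ (fromWitness {a? = F ≟ₛ F} refl)))

s+t<2s+t∸1 : ∀ {s t} → 2 ≤ s → s + t < 2 * s + t ∸ 1
s+t<2s+t∸1 {s} {t} 2≤s = begin-strict
  s + t            <⟨ m<m+n (s + t) (m+n≤o⇒m≤o∸n 1 2≤s) ⟩
  s + t + (s ∸ 1)  ≡⟨ sym (+-∸-assoc (s + t) (≤-trans (s≤s z≤n) 2≤s)) ⟩
  s + t + s ∸ 1    ≡⟨ cong (_∸ 1) (s+t+s≡2s+t s t) ⟩
  2 * s + t ∸ 1    ∎
  where
  open ≤-Reasoning
  s+t+s≡2s+t : ∀ s t → s + t + s ≡ 2 * s + t
  s+t+s≡2s+t = solve-∀

-- ∣ ∁ F ∣ ≥ 2 because F ∉ 𝓕₁ while ∁ F meets [s+t-1].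
complement-∈𝓖₁ : ∀ {s t n} (C : Construction s t n) {F : Subset n} → ¬ 𝓕 C F
               → s + t ≤ n → ∣ F ∩ Low s t ∣ < s + t ∸ 1 → t + (n ∸ (s + t)) ≤ ∣ F ∣
               → (∀ z → z ∉ F → elem z ≤ 2 * s + t ∸ 1) → 𝓖₁ s t F
complement-∈𝓖₁ {s} {t} {n} C {F} F∉𝓕 s+t≤n ∣F∩Low∣<s+t∸1 t+r≤∣F∣ outside-F≤ =
  ∁ F , ∁F⊆ , 2≤∣∁F∣ , ∣∁F∣≤s , sym (∁-involutive F)
  where
  x∈Low∖F : ∃ λ x → x ∈ Low s t × x ∉ F
  x∈Low∖F = ∣p∩q∣<∣q∣⇒∃∉ F (Low s t)
    (subst (∣ F ∩ Low s t ∣ <_) (sym (∣[1,m]∣≡m n (s + t ∸ 1) (≤-trans (m∸n≤m (s + t) 1) s+t≤n))) ∣F∩Low∣<s+t∸1)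
  x : Fin n
  x = proj₁ x∈Low∖F
  ⁅x⁆⊆∁F : ⁅ x ⁆ ⊆ ∁ F
  ⁅x⁆⊆∁F y∈⁅x⁆ = subst (_∈ ∁ F) (sym (x∈⁅y⁆⇒x≡y x y∈⁅x⁆)) (x∉p⇒x∈∁p (proj₂ (proj₂ x∈Low∖F)))
  ∁F⊆ : ∁ F ⊆ interval 1 (2 * s + t ∸ 1)
  ∁F⊆ {y} y∈∁F = ∈-interval⁺ (s≤s z≤n) (outside-F≤ y (x∈∁p⇒x∉p y∈∁F))
  ∣∁F∣≤s : ∣ ∁ F ∣ ≤ s
  ∣∁F∣≤s = subst (_≤ s) (sym (∣∁p∣≡n∸∣p∣ F)) (m≤n+o⇒m∸n≤o n ∣ F ∣ (begin
    n                            ≡⟨ sym (m+[n∸m]≡n s+t≤n) ⟩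
    s + t + (n ∸ (s + t))        ≡⟨ +-assoc s t _ ⟩
    s + (t + (n ∸ (s + t)))      ≤⟨ +-monoʳ-≤ s t+r≤∣F∣ ⟩
    s + ∣ F ∣                    ≡⟨ +-comm s ∣ F ∣ ⟩
    ∣ F ∣ + s                    ∎))
    where open ≤-Reasoning
  2≤∣∁F∣ : 2 ≤ ∣ ∁ F ∣
  2≤∣∁F∣ with 2 ≤? ∣ ∁ F ∣
  ... | yes 2≤ = 2≤
  ... | no  2≰ = ⊥-elim (F∉𝓕 (inj₁ (inj₂ (x , proj₂ (∈-interval⁻ {a = 1} (proj₁ (proj₂ x∈Low∖F))) , F≡∁⁅x⁆))))
    where
    ⁅x⁆≡∁F : ⁅ x ⁆ ≡ ∁ F
    ⁅x⁆≡∁F = p⊆q∧∣p∣≡∣q∣⇒p≡q ⁅x⁆⊆∁F (trans (∣⁅x⁆∣≡1 x)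
      (≤-antisym (subst (_≤ ∣ ∁ F ∣) (∣⁅x⁆∣≡1 x) (p⊆q⇒∣p∣≤∣q∣ ⁅x⁆⊆∁F)) (s≤s⁻¹ (≰⇒> 2≰))))
    F≡∁⁅x⁆ : F ≡ ∁ ⁅ x ⁆
    F≡∁⁅x⁆ = trans (sym (∁-involutive F)) (cong ∁ (sym ⁅x⁆≡∁F))

module ThroughUpperLantern {s′ t′ n : ℕ} (C : Construction (2 + s′) (2 + t′) n)
  {F : Subset n} (F∉𝓕 : ¬ 𝓕 C F)
  {A : Subset n} (A⊆F : A ⊆ F) (A⊆Low : A ⊆ Low (2 + s′) (2 + t′)) (∣A∣≡t : ∣ A ∣ ≡ 2 + t′) where

  open Construction C

  private
    s t r : ℕ
    s = 2 + s′
    t = 2 + t′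
    r = n ∸ (s + t)

    lantern : IsUpperLantern s t A (up A)
    lantern = up-ok A A⊆Low ∣A∣≡t

    complete : ∀ i → IsCompleteChain A (Top s t A) (up A i)
    complete = proj₁ (proj₁ lantern)

    level-size : ∀ i j → ∣ up A i j ∣ ≡ t + toℕ j
    level-size i j = trans (proj₂ (proj₂ (complete-chain-sizes (up A i) (complete i)) j)) (cong (_+ toℕ j) ∣A∣≡t)

    top-size : ∣ Top s t A ∣ ≡ t + r
    top-size = trans (proj₁ (complete-chain-sizes (up A zero) (complete zero))) (cong (_+ r) ∣A∣≡t)

    F≢level : ∀ i j → F ≢ up A i j
    F≢level i j F≡Lij = F∉𝓕 (subst (𝓕 C) (sym F≡Lij) (inj₂ (inj₁ (A , A⊆Low , ∣A∣≡t , i , j , refl))))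

    t<∣F∣ : t < ∣ F ∣
    t<∣F∣ = ≤∧≢⇒< (subst (_≤ ∣ F ∣) ∣A∣≡t (p⊆q⇒∣p∣≤∣q∣ A⊆F)) λ t≡∣F∣ →
      F≢level zero zero (sym (trans (proj₁ (complete zero)) (p⊆q∧∣p∣≡∣q∣⇒p≡q A⊆F (trans ∣A∣≡t t≡∣F∣))))

  inducedK-at-level : (j : Fin (suc r)) → 1 ≤ toℕ j → toℕ j < r → (∀ i → Incomparable F (up A i j))
                    → InducedK s t (λ X → 𝓕 C X ⊎ X ≡ F)
  inducedK-at-level j 0<j j<r F∥level = inducedK {Q = λ X → 𝓕 C X ⊎ X ≡ F} f f∈𝓕+F
    (antichain-over-points⇒IsKEmbedding U e e-inj e∈U
      (antichain-∷ F∥level (injective∧equal-size⇒antichain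
        (lantern-level-injective (proj₁ lantern) j 0<j j<r) (λ i → level-size i j))))
    where
    U : Fin s → Subset n
    U = F Vector.∷ λ i → up A i j
    e : Fin t → Fin n
    e = proj₁ (enumerate-sized A ∣A∣≡t)
    e-inj : Injective _≡_ _≡_ e
    e-inj = proj₁ (proj₂ (enumerate-sized A ∣A∣≡t))
    e∈A : ∀ k → e k ∈ A
    e∈A = proj₂ (proj₂ (enumerate-sized A ∣A∣≡t))
    e∈U : ∀ i k → e k ∈ U i
    e∈U zero    k = A⊆F (e∈A k)
    e∈U (suc i) k = proj₁ (proj₂ (complete-chain-sizes (up A i) (complete i)) j) (e∈A k)
    f : Fin s ⊎ Fin t → Subset n
    f = [ U , ⁅_⁆ ∘ e ]′
    f∈𝓕+F : ∀ x → 𝓕 C (f x) ⊎ f x ≡ F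
    f∈𝓕+F (inj₁ zero)    = inj₂ refl
    f∈𝓕+F (inj₁ (suc i)) = inj₁ (inj₂ (inj₁ (A , A⊆Low , ∣A∣≡t , i , j , refl)))
    f∈𝓕+F (inj₂ k)       = inj₁ (inj₂ (inj₂ (inj₂ (inj₁ (inj₂ (e k , proj₂ (∈-interval⁻ {a = 1} (A⊆Low (e∈A k))) , refl))))))

  inducedK-if-∣F∣<t+r : ∣ F ∣ < t + r → InducedK s t (λ X → 𝓕 C X ⊎ X ≡ F)
  inducedK-if-∣F∣<t+r ∣F∣<t+r =
    inducedK-at-level j (subst (1 ≤_) (sym j≡d) (m<n⇒0<n∸m t<∣F∣)) (subst (_< r) (sym j≡d) d<r)
      λ i → ≢∧equal-size⇒incomparable (F≢level i j) (sym (level∣F∣ i))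
    where
    d : ℕ
    d = ∣ F ∣ ∸ t
    t+d≡∣F∣ : t + d ≡ ∣ F ∣
    t+d≡∣F∣ = m+[n∸m]≡n (<⇒≤ t<∣F∣)
    d<r : d < r
    d<r = +-cancelˡ-< t d r (subst (_< t + r) (sym t+d≡∣F∣) ∣F∣<t+r)
    j : Fin (suc r)
    j = fromℕ< (m<n⇒m<1+n d<r)
    j≡d : toℕ j ≡ d
    j≡d = toℕ-fromℕ< (m<n⇒m<1+n d<r)
    level∣F∣ : ∀ i → ∣ up A i j ∣ ≡ ∣ F ∣
    level∣F∣ i = trans (level-size i j) (trans (cong (t +_) j≡d) t+d≡∣F∣)

  inducedK-if-missing-beyond : t + r ≤ ∣ F ∣ → {z : Fin n} → z ∉ F → 2 * s + t ∸ 1 < elem z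
                             → InducedK s t (λ X → 𝓕 C X ⊎ X ≡ F)
  inducedK-if-missing-beyond t+r≤∣F∣ {z} z∉F 2s+t∸1<z =
    inducedK-at-level j (subst (1 ≤_) (sym j≡r-1) (m+n≤o⇒m≤o∸n 1 2≤r)) (subst (_< r) (sym j≡r-1) r-1<r)
      λ i → (λ F⊆level → <⇒≱ (≤-trans (≤-reflexive (suc∣level∣≡∣top∣ i)) (≤-trans (≤-reflexive top-size) t+r≤∣F∣))
                             (p⊆q⇒∣p∣≤∣q∣ F⊆level)) ,
            (λ level⊆F → z∉F (level⊆F (z∈level i)))
    where
    s+t+1<z : suc (s + t) < elem z
    s+t+1<z = <-≤-trans (s≤s (s+t<2s+t∸1 {s} {t} (s≤s (s≤s z≤n)))) 2s+t∸1<z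
    2≤r : 2 ≤ r
    2≤r = m+n≤o⇒m≤o∸n 2 (≤-trans s+t+1<z (toℕ<n z))
    r-1<r : r ∸ 1 < r
    r-1<r = ∸-monoʳ-< (s≤s z≤n) (≤-trans (s≤s z≤n) 2≤r)
    j : Fin (suc r)
    j = fromℕ< (s≤s (m∸n≤m r 1))
    j≡r-1 : toℕ j ≡ r ∸ 1
    j≡r-1 = toℕ-fromℕ< (s≤s (m∸n≤m r 1))
    suc∣level∣≡∣top∣ : ∀ i → suc ∣ up A i j ∣ ≡ ∣ Top s t A ∣
    suc∣level∣≡∣top∣ i = begin
      suc ∣ up A i j ∣      ≡⟨ cong suc (trans (level-size i j) (cong (t +_) j≡r-1)) ⟩
      suc (t + (r ∸ 1))     ≡⟨ sym (+-suc t (r ∸ 1)) ⟩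
      t + suc (r ∸ 1)       ≡⟨ cong (t +_) (trans (+-comm 1 (r ∸ 1)) (m∸n+n≡m (≤-trans (s≤s z≤n) 2≤r))) ⟩
      t + r                 ≡⟨ sym top-size ⟩
      ∣ Top s t A ∣         ∎
      where open ≡-Reasoning
    z∈level : ∀ i → z ∈ up A i j
    z∈level i with z ∈? up A i j
    ... | yes z∈Lij = z∈Lij
    ... | no  z∉Lij = ⊥-elim (<⇒≱ 2s+t∸1<z (proj₂ (∈-interval⁻ {a = suc (s + t)} (proj₁ (proj₂ lantern z) (z∈top , z∉⋂level)))))
      where
      z∈top : z ∈ Top s t A
      z∈top = x∈p∪q⁺ (inj₂ (∈-interval⁺ (<⇒≤ s+t+1<z) (toℕ<n z)))
      z∉⋂level : ¬ (∀ Y → Y ∈L up A → suc ∣ Y ∣ ≡ ∣ Top s t A ∣ → z ∈ Y)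
      z∉⋂level z∈all = z∉Lij (z∈all (up A i j) (i , j , refl) (suc∣level∣≡∣top∣ i))

  inducedK-through-lantern : 2 * s + t ∸ 1 ≤ n → ∣ F ∩ Low s t ∣ < s + t ∸ 1
                           → InducedK s t (λ X → 𝓕 C X ⊎ X ≡ F)
  inducedK-through-lantern 2s+t∸1≤n ∣F∩Low∣<s+t∸1 with ∣ F ∣ <? t + r
  ... | yes ∣F∣<t+r = inducedK-if-∣F∣<t+r ∣F∣<t+r
  ... | no  ∣F∣≮t+r with any? (λ z → ¬? (z ∈? F) ×-dec (2 * s + t ∸ 1 <? elem z))
  ...   | yes (z , z∉F , beyond) = inducedK-if-missing-beyond (≮⇒≥ ∣F∣≮t+r) z∉F beyond
  ...   | no  none = 𝓖-member⇒inducedK C F∉𝓕 (inj₁ (complement-∈𝓖₁ C F∉𝓕 s+t≤n ∣F∩Low∣<s+t∸1 (≮⇒≥ ∣F∣≮t+r)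
                       λ z z∉F → ≮⇒≥ λ beyond → none (z , z∉F , beyond)))
    where
    s+t≤n : s + t ≤ n
    s+t≤n = <⇒≤ (<-≤-trans (s+t<2s+t∸1 {s} {t} (s≤s (s≤s z≤n))) 2s+t∸1≤n)

lemma6 : (s t n : ℕ) → 2 ≤ t → t ≤ s → 2 * s + t ∸ 1 ≤ n
       → (C : Construction s t n)
       → (F : Subset n) → ¬ 𝓕 C F
       → t ≤ ∣ F ∩ Low s t ∣ → ∣ F ∩ Low s t ∣ < s + t ∸ 1
       → InducedK s t (λ X → 𝓕 C X ⊎ X ≡ F)
lemma6 s t n (s≤s (s≤s _)) (s≤s (s≤s _)) 2s+t∸1≤n C F F∉𝓕 t≤∣F∩Low∣ ∣F∩Low∣<s+t∸1
  with ∃-subset-of-size (F ∩ Low s t) t≤∣F∩Low∣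
... | A , A⊆F∩Low , ∣A∣≡t =
  ThroughUpperLantern.inducedK-through-lantern C F∉𝓕
    (⊆-trans A⊆F∩Low (p∩q⊆p F (Low s t))) (⊆-trans A⊆F∩Low (p∩q⊆q F (Low s t))) ∣A∣≡t
    2s+t∸1≤n ∣F∩Low∣<s+t∸1
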